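{- Let $n$ be a positive even integer and let $G=K_{2^{n/2}}\,\square\,K_{2^{n/2}}$. Then $WL(G,Q_n)=n2^{3n/2-2}$.
   Context: $Q_n$ is the $n$-dimensional hypercube: vertex set $\{0,1\}^n$, two vertices adjacent iff they differ in exactly one coordinate. $K_m$ is the complete graph on $m$ vertices. The Cartesian product $G\,\square\,H$ has vertex set $V(G)\times V(H)$, with $(g,h)$ adjacent to $(g',h')$ iff either $g=g'$ and $hh'\in E(H)$, or $h=h'$ and $gg'\in E(G)$. An embedding of a graph $G$ into a graph $H$ is a pair $(f,P_f)$ where $f:V(G)\to V(H)$ is injective and $P_f$ assigns to each edge $uv\in E(G)$ a path in $H$ between $f(u)$ and $f(v)$. The wirelength of the embedding is $WL_f(G,H)=\sum_{e\in E(G)}|P_f(e)|$, and $WL(G,H)$ is the minimum of $WL_f(G,H)$ over all embeddings of $G$ into $H$. -}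

module Defs where

open import Data.Nat using (ℕ; zero; suc; _+_; _*_; _^_; _<_; _≤_)
open import Data.Nat.Properties using (_<?_)
open import Data.Bool using (Bool; true; false; _xor_)
open import Data.Fin using (Fin; toℕ)
open import Data.Fin.Properties using (_≟_)
open import Data.Vec using (Vec; zipWith; toList)
open import Data.Nat.ListAction using (sum)
open import Data.List using (List; []; _∷_; length; map; filter; cartesianProduct; allFin)
open import Data.List.Relation.Unary.Unique.Propositional using (Unique)
open import Data.List.Membership.Propositional using (_∈_)
open import Data.Product using (Σ; _×_; _,_)
open import Data.Sum using (_⊎_)
open import Relation.Nullary using (¬_; Dec; ¬?)
open import Relation.Nullary.Decidable using (_×-dec_; _⊎-dec_)
open import Relation.Binary.PropositionalEquality using (_≡_; _≢_)
open import Function.Definitions using (Injective)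

QVertex : ℕ → Set
QVertex n = Vec Bool n

bitDiff : Bool → Bool → ℕ
bitDiff a b with a xor b
... | true  = 1
... | false = 0

hamming : ∀ {n} → QVertex n → QVertex n → ℕ
hamming x y = sum (toList (zipWith bitDiff x y))

QAdj : ∀ {n} → QVertex n → QVertex n → Set
QAdj x y = hamming x y ≡ 1

-- A path in Q_n from x to y given by the list of vertices after x.
-- Its length (number of edges) is the length of that list.
WalkQ : ∀ {n} → QVertex n → QVertex n → List (QVertex n) → Set
WalkQ x y []       = x ≡ y
WalkQ x y (z ∷ zs) = QAdj x z × WalkQ z y zs

IsPathQ : ∀ {n} → QVertex n → QVertex n → List (QVertex n) → Set
IsPathQ x y zs = WalkQ x y zs × Unique (x ∷ zs)

GVertex : ℕ → Set
GVertex m = Fin m × Fin m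

GAdj : ∀ {m} → GVertex m → GVertex m → Set
GAdj (g , h) (g' , h') = (g ≡ g' × h ≢ h') ⊎ (h ≡ h' × g ≢ g')

GAdj? : ∀ {m} (u v : GVertex m) → Dec (GAdj u v)
GAdj? (g , h) (g' , h') =
  ((g ≟ g') ×-dec ¬? (h ≟ h')) ⊎-dec ((h ≟ h') ×-dec ¬? (g ≟ g'))

-- a linear order on vertices, used to list each unordered edge exactly once
key : ∀ {m} → GVertex m → ℕ
key {m} (g , h) = toℕ g * m + toℕ h

IsListedEdge : ∀ {m} → GVertex m × GVertex m → Set
IsListedEdge (u , v) = GAdj u v × key u < key v

IsListedEdge? : ∀ {m} (e : GVertex m × GVertex m) → Dec (IsListedEdge e)
IsListedEdge? (u , v) = GAdj? u v ×-dec (key u <? key v)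

allGVertices : ∀ m → List (GVertex m)
allGVertices m = cartesianProduct (allFin m) (allFin m)

edgesG : ∀ m → List (GVertex m × GVertex m)
edgesG m = filter IsListedEdge? (cartesianProduct (allGVertices m) (allGVertices m))

record Embedding (m n : ℕ) : Set where
  field
    f     : GVertex m → QVertex n
    f-inj : Injective _≡_ _≡_ f
    -- P u v : the path assigned to edge uv (vertices after f u); only
    -- its values on edges matter
    P     : GVertex m → GVertex m → List (QVertex n)
    P-ok  : ∀ {u v} → (u , v) ∈ edgesG m → IsPathQ (f u) (f v) (P u v)

wirelength : ∀ {m n} → Embedding m n → ℕ
wirelength {m} E = sum (map (λ e → length (P (Σ.proj₁ e) (Σ.proj₂ e))) (edgesG m))
  where open Embedding E

WLis : ℕ → ℕ → ℕ → Set
WLis m n w = Σ (Embedding m n) (λ E → wirelength E ≡ w) × (∀ (E : Embedding m n) → w ≤ wirelength E)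

module Submission where

open import Defs
open import Data.Nat hiding (_≟_)
open import Data.Nat.Properties hiding (_≟_)
open import Data.Nat.ListAction using (sum)
open import Data.Nat.ListAction.Properties using (sum-++)
open import Data.Nat.Tactic.RingSolver using (solve-∀)
open import Algebra.Properties.CommutativeSemigroup +-commutativeSemigroup using (x∙yz≈y∙xz)
open import Algebra.Properties.Semiring.Sum +-*-semiring
  using (sum-syntax; ∑-distrib-+; ∑-comm; *-distribˡ-sum; sum-cong-≗)
  renaming (sum to ∑)
open import Data.Bool using (Bool; true; false; _∧_)
import Data.Bool.Properties as Bool
open import Data.Empty using (⊥; ⊥-elim)
open import Data.Fin using (Fin; zero; suc; toℕ; splitAt; combine; finToFun; funToFin)
open import Data.Fin.Properties using (_≟_; toℕ-injective; 2↔Bool; funToFin-finToFin)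
open import Data.List using (List; []; _∷_; _++_; map; length; filter; cartesianProduct; allFin; tabulate)
open import Data.List.Properties
  using (map-++; map-∘; map-cong; map-tabulate; length-map; length-++; length-tabulate)
open import Data.List.Membership.Propositional using (_∈_)
open import Data.List.Relation.Unary.Any using (here; there)
open import Data.List.Relation.Unary.All using (All)
import Data.List.Relation.Unary.All as All
import Data.List.Relation.Unary.All.Properties as All
open import Data.List.Relation.Unary.AllPairs using (AllPairs; []; _∷_)
import Data.List.Relation.Unary.AllPairs as AllPairs
import Data.List.Relation.Unary.AllPairs.Properties as AllPairs
open import Data.List.Relation.Unary.Unique.Propositional using (Unique)
import Data.List.Relation.Unary.Unique.Propositional.Properties as Unique
open import Data.Product using (_×_; _,_; proj₁; proj₂; uncurry; ∃)
open import Data.Sum using (_⊎_; inj₁; inj₂; [_,_]′)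
open import Data.Vec as Vec using (Vec; []; _∷_; lookup)
open import Data.Vec.Properties using (lookup∘tabulate; lookup-splitAt; ++-injectiveˡ; ++-injectiveʳ)
open import Function using (_∘_; id)
open import Function.Bundles using (mk⇔; Inverse)
open import Function.Definitions using (Injective)
open import Relation.Binary.PropositionalEquality
open import Relation.Nullary using (Dec; does; yes; no; ¬_)
open import Relation.Nullary.Decidable using (does-⇔)
open import Relation.Unary using (Pred; Decidable)

-- A path joining f u and f v has at least hamming (f u) (f v) edges, and a geodesic achieves
-- this, so WL(G, Q_n) is the minimum over injections f of Σ_{uv ∈ E(G)} hamming (f u) (f v).
-- This sum splits over the n coordinates: coordinate i colours the m × m grid of G = K_m □ K_m,
-- and contributes the number of edges of G joining differently coloured vertices. When
-- m² = 2ⁿ, f is a bijection onto Q_n, so every colouring has exactly m²/2 ones, and the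
-- edge-isoperimetric inequality m·|∂S| ≥ |S|·(m² − |S|) for K_m □ K_m bounds each coordinate's
-- contribution below by m³/4. To prove that inequality, split ∂S into edges inside rows and
-- edges inside columns. With a_g the number of ones in row g, the row part is Σ_g a_g (m − a_g)
-- exactly, and the column edges between rows g and g' number at least
-- |a_g − a_g'| ≥ (a_g − a_g')²/m; a variance identity for the a_g then gives the bound. Equality holds when the colouring depends
-- on the row index only or on the column index only, as it does for every coordinate of the
-- embedding (g , h) ↦ binary g ++ binary h.

bit : Bool → ℕ
bit true  = 1
bit false = 0

∑-mono : ∀ {m} {f g : Fin m → ℕ} → (∀ i → f i ≤ g i) → ∑ f ≤ ∑ g
∑-mono {zero}  f≤g = z≤n
∑-mono {suc m} f≤g = +-mono-≤ (f≤g zero) (∑-mono (f≤g ∘ suc))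

∑-const : ∀ m c → ∑[ i < m ] c ≡ m * c
∑-const zero    c = refl
∑-const (suc m) c = cong (c +_) (∑-const m c)

∑-distribʳ-* : ∀ {m} c (f : Fin m → ℕ) → ∑[ i < m ] (f i * c) ≡ ∑ f * c
∑-distribʳ-* {m} c f = begin
  ∑[ i < m ] (f i * c)  ≡⟨ sum-cong-≗ (λ i → *-comm (f i) c) ⟩
  ∑[ i < m ] (c * f i)  ≡⟨ *-distribˡ-sum c f ⟨
  c * ∑ f               ≡⟨ *-comm c (∑ f) ⟩
  ∑ f * c               ∎
  where open ≡-Reasoning

δ : ∀ {m} → Fin m → Fin m → ℕ
δ i j = bit (does (i ≟ j))

∑-δ : ∀ {m} (i : Fin m) (f : Fin m → ℕ) → ∑[ j < m ] (δ i j * f j) ≡ f i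
∑-δ {suc m} zero    f =
  trans (cong₂ _+_ (*-identityˡ (f zero)) (trans (∑-const m 0) (*-zeroʳ m))) (+-identityʳ (f zero))
∑-δ {suc m} (suc i) f = ∑-δ i (f ∘ suc)

∑² : ∀ {m} → (Fin m → Fin m → ℕ) → ℕ
∑² {m} F = ∑[ i < m ] ∑[ j < m ] F i j

∑²-cong : ∀ {m} {F G : Fin m → Fin m → ℕ} → (∀ i j → F i j ≡ G i j) → ∑² F ≡ ∑² G
∑²-cong F≗G = sum-cong-≗ (λ i → sum-cong-≗ (F≗G i))

∑²-mono : ∀ {m} {F G : Fin m → Fin m → ℕ} → (∀ i j → F i j ≤ G i j) → ∑² F ≤ ∑² G
∑²-mono F≤G = ∑-mono (λ i → ∑-mono (F≤G i))

∑²-distrib-+ : ∀ {m} (F G : Fin m → Fin m → ℕ) → ∑² (λ i j → F i j + G i j) ≡ ∑² F + ∑² G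
∑²-distrib-+ F G =
  trans (sum-cong-≗ (λ i → ∑-distrib-+ (F i) (G i))) (∑-distrib-+ (λ i → ∑ (F i)) (λ i → ∑ (G i)))

*-distribˡ-∑² : ∀ {m} c (F : Fin m → Fin m → ℕ) → c * ∑² F ≡ ∑² (λ i j → c * F i j)
*-distribˡ-∑² c F =
  trans (*-distribˡ-sum c (λ i → ∑ (F i))) (sum-cong-≗ (λ i → *-distribˡ-sum c (F i)))

∑²-comm-∑ : ∀ {m n} (F : Fin m → Fin m → Fin n → ℕ) →
  ∑² (λ i j → ∑[ k < n ] F i j k) ≡ ∑[ k < n ] ∑² (λ i j → F i j k)
∑²-comm-∑ {m} F = trans (sum-cong-≗ (λ i → ∑-comm (F i))) (∑-comm (λ i k → ∑[ j < m ] F i j k))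

∑²-product : ∀ {m} (f g : Fin m → ℕ) → ∑² (λ i j → f i * g j) ≡ ∑ f * ∑ g
∑²-product {m} f g = begin
  ∑² (λ i j → f i * g j)  ≡⟨ sum-cong-≗ (λ i → *-distribˡ-sum (f i) g) ⟨
  ∑[ i < m ] (f i * ∑ g)  ≡⟨ ∑-distribʳ-* (∑ g) f ⟩
  ∑ f * ∑ g               ∎
  where open ≡-Reasoning

∑²-+ : ∀ {m} (g : Fin m → ℕ) → ∑² (λ i j → g i + g j) ≡ 2 * (m * ∑ g)
∑²-+ {m} g = begin
  ∑² (λ i j → g i + g j)
    ≡⟨ ∑²-distrib-+ (λ i j → g i) (λ i j → g j) ⟩
  ∑² (λ i j → g i) + ∑² (λ i j → g j)
    ≡⟨ cong₂ _+_ (sum-cong-≗ (λ i → ∑-const m (g i))) (∑-const m (∑ g)) ⟩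
  ∑[ i < m ] (m * g i) + m * ∑ g
    ≡⟨ cong (_+ m * ∑ g) (*-distribˡ-sum m g) ⟨
  m * ∑ g + m * ∑ g
    ≡⟨ cong (m * ∑ g +_) (+-identityʳ (m * ∑ g)) ⟨
  2 * (m * ∑ g) ∎
  where open ≡-Reasoning

∑²-quadratic : ∀ {m} (D : Fin m → Fin m → ℕ) (f g : Fin m → ℕ) →
  (∀ i j → D i j + 2 * (f i * f j) ≡ g i + g j) →
  ∑² D + 2 * (∑ f * ∑ f) ≡ 2 * (m * ∑ g)
∑²-quadratic {m} D f g pointwise = begin
  ∑² D + 2 * (∑ f * ∑ f)               ≡⟨ cong (λ t → ∑² D + 2 * t) (∑²-product f f) ⟨
  ∑² D + 2 * ∑² (λ i j → f i * f j)    ≡⟨ cong (∑² D +_) (*-distribˡ-∑² 2 (λ i j → f i * f j)) ⟩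
  ∑² D + ∑² (λ i j → 2 * (f i * f j))  ≡⟨ ∑²-distrib-+ D (λ i j → 2 * (f i * f j)) ⟨
  ∑² (λ i j → D i j + 2 * (f i * f j)) ≡⟨ ∑²-cong pointwise ⟩
  ∑² (λ i j → g i + g j)               ≡⟨ ∑²-+ g ⟩
  2 * (m * ∑ g)                        ∎
  where open ≡-Reasoning

sum-tabulate : ∀ m (F : Fin m → ℕ) → sum (tabulate F) ≡ ∑ F
sum-tabulate zero    F = refl
sum-tabulate (suc m) F = cong (F zero +_) (sum-tabulate m (F ∘ suc))

sum-map-allFin : ∀ m (F : Fin m → ℕ) → sum (map F (allFin m)) ≡ ∑ F
sum-map-allFin m F = trans (cong sum (map-tabulate id F)) (sum-tabulate m F)

sum-map-filter : ∀ {a p} {A : Set a} {P : Pred A p} (P? : Decidable P) (F : A → ℕ) xs →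
  sum (map F (filter P? xs)) ≡ sum (map (λ x → bit (does (P? x)) * F x) xs)
sum-map-filter P? F []       = refl
sum-map-filter P? F (x ∷ xs) with does (P? x)
... | true  = cong₂ _+_ (sym (+-identityʳ (F x))) (sum-map-filter P? F xs)
... | false = sum-map-filter P? F xs

sum-map-cartesianProduct : ∀ {a b} {A : Set a} {B : Set b} (F : A × B → ℕ) xs ys →
  sum (map F (cartesianProduct xs ys)) ≡ sum (map (λ x → sum (map (λ y → F (x , y)) ys)) xs)
sum-map-cartesianProduct F []       ys = refl
sum-map-cartesianProduct F (x ∷ xs) ys = begin
  sum (map F (map (x ,_) ys ++ cartesianProduct xs ys))
    ≡⟨ cong sum (map-++ F (map (x ,_) ys) _) ⟩
  sum (map F (map (x ,_) ys) ++ map F (cartesianProduct xs ys))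
    ≡⟨ sum-++ (map F (map (x ,_) ys)) _ ⟩
  sum (map F (map (x ,_) ys)) + sum (map F (cartesianProduct xs ys))
    ≡⟨ cong₂ _+_ (cong sum (sym (map-∘ ys))) (sum-map-cartesianProduct F xs ys) ⟩
  sum (map (λ y → F (x , y)) ys) + sum (map (λ x → sum (map (λ y → F (x , y)) ys)) xs) ∎
  where open ≡-Reasoning

sum-map-mono-∈ : ∀ {a} {A : Set a} {F G : A → ℕ} xs → (∀ x → x ∈ xs → F x ≤ G x) →
  sum (map F xs) ≤ sum (map G xs)
sum-map-mono-∈ []       F≤G = z≤n
sum-map-mono-∈ (x ∷ xs) F≤G =
  +-mono-≤ (F≤G x (here refl)) (sum-map-mono-∈ xs (λ y y∈ → F≤G y (there y∈)))

length-cartesianProduct : ∀ {a b} {A : Set a} {B : Set b} (xs : List A) (ys : List B) →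
  length (cartesianProduct xs ys) ≡ length xs * length ys
length-cartesianProduct []       ys = refl
length-cartesianProduct (x ∷ xs) ys =
  trans (length-++ (map (x ,_) ys)) (cong₂ _+_ (length-map (x ,_) ys) (length-cartesianProduct xs ys))

∑ᵥ : ∀ {m} → (GVertex m → ℕ) → ℕ
∑ᵥ F = ∑² (λ g h → F (g , h))

∑ᵥ-cong : ∀ {m} {F G : GVertex m → ℕ} → (∀ u → F u ≡ G u) → ∑ᵥ F ≡ ∑ᵥ G
∑ᵥ-cong F≗G = ∑²-cong (λ g h → F≗G (g , h))

∑ᵥ∑ᵥ-distrib-+ : ∀ {m} (F G : GVertex m → GVertex m → ℕ) →
  ∑ᵥ (λ u → ∑ᵥ (λ v → F u v + G u v)) ≡ ∑ᵥ (λ u → ∑ᵥ (F u)) + ∑ᵥ (λ u → ∑ᵥ (G u))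
∑ᵥ∑ᵥ-distrib-+ F G =
  trans (∑ᵥ-cong (λ u → ∑²-distrib-+ (λ g h → F u (g , h)) (λ g h → G u (g , h))))
        (∑²-distrib-+ (λ g h → ∑ᵥ (F (g , h))) (λ g h → ∑ᵥ (G (g , h))))

∑ᵥ-comm-∑ : ∀ {m n} (F : GVertex m → Fin n → ℕ) →
  ∑ᵥ (λ u → ∑[ i < n ] F u i) ≡ ∑[ i < n ] ∑ᵥ (λ u → F u i)
∑ᵥ-comm-∑ F = ∑²-comm-∑ (λ g h → F (g , h))

∑ᵥ-comm : ∀ {m} (F : GVertex m → GVertex m → ℕ) →
  ∑ᵥ (λ u → ∑ᵥ (F u)) ≡ ∑ᵥ (λ v → ∑ᵥ (λ u → F u v))
∑ᵥ-comm {m} F =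
  trans (∑ᵥ-comm-∑ (λ u g' → ∑[ h' < m ] F u (g' , h')))
        (sum-cong-≗ (λ g' → ∑ᵥ-comm-∑ (λ u h' → F u (g' , h'))))

sum-map-allGVertices : ∀ m (F : GVertex m → ℕ) → sum (map F (allGVertices m)) ≡ ∑ᵥ F
sum-map-allGVertices m F = begin
  sum (map F (allGVertices m))
    ≡⟨ sum-map-cartesianProduct F (allFin m) (allFin m) ⟩
  sum (map (λ g → sum (map (λ h → F (g , h)) (allFin m))) (allFin m))
    ≡⟨ cong sum (map-cong (λ g → sum-map-allFin m _) (allFin m)) ⟩
  sum (map (λ g → ∑[ h < m ] F (g , h)) (allFin m))
    ≡⟨ sum-map-allFin m _ ⟩
  ∑ᵥ F ∎
  where open ≡-Reasoning

adjacency : ∀ {m} → GVertex m → GVertex m → ℕ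
adjacency u v = bit (does (GAdj? u v))

listed : ∀ {m} → GVertex m → GVertex m → ℕ
listed u v = bit (does (IsListedEdge? (u , v)))

GAdj-sym : ∀ {m} {u v : GVertex m} → GAdj u v → GAdj v u
GAdj-sym (inj₁ (g≡g' , h≢h')) = inj₁ (sym g≡g' , h≢h' ∘ sym)
GAdj-sym (inj₂ (h≡h' , g≢g')) = inj₂ (sym h≡h' , g≢g' ∘ sym)

GAdj⇒key≢ : ∀ {m} {u v : GVertex m} → GAdj u v → key u ≢ key v
GAdj⇒key≢ {m} {g , h} (inj₁ (refl , h≢h')) eq =
  h≢h' (toℕ-injective (+-cancelˡ-≡ (toℕ g * m) _ _ eq))
GAdj⇒key≢ {suc m} {g , h} (inj₂ (refl , g≢g')) eq =
  g≢g' (toℕ-injective (*-cancelʳ-≡ (toℕ g) _ (suc m) (+-cancelʳ-≡ (toℕ h) _ _ eq)))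

bit-∧-+-bit-∧ : ∀ {A B C : Set} (a : Dec A) (b : Dec B) (c : Dec C) →
  (A → B → C → ⊥) → (A → ¬ B → ¬ C → ⊥) →
  bit (does a ∧ does b) + bit (does a ∧ does c) ≡ bit (does a)
bit-∧-+-bit-∧ (no _)  _       _       _        _       = refl
bit-∧-+-bit-∧ (yes a) (yes b) (yes c) not-both _       = ⊥-elim (not-both a b c)
bit-∧-+-bit-∧ (yes _) (yes _) (no _)  _        _       = refl
bit-∧-+-bit-∧ (yes _) (no _)  (yes _) _        _       = refl
bit-∧-+-bit-∧ (yes a) (no ¬b) (no ¬c) _        neither = ⊥-elim (neither a ¬b ¬c)

listed+listed≡adjacency : ∀ {m} (u v : GVertex m) → listed u v + listed v u ≡ adjacency u v
listed+listed≡adjacency u v rewrite does-⇔ (mk⇔ GAdj-sym GAdj-sym) (GAdj? v u) (GAdj? u v) =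
  bit-∧-+-bit-∧ (GAdj? u v) (key u <? key v) (key v <? key u) (λ _ → <-asym)
    (λ uv u≮v v≮u → GAdj⇒key≢ uv (≤-antisym (≮⇒≥ v≮u) (≮⇒≥ u≮v)))

sum-map-edgesG : ∀ m (F : GVertex m → GVertex m → ℕ) →
  sum (map (λ e → F (proj₁ e) (proj₂ e)) (edgesG m)) ≡ ∑ᵥ (λ u → ∑ᵥ (λ v → listed u v * F u v))
sum-map-edgesG m F = begin
  sum (map (λ e → F (proj₁ e) (proj₂ e)) (edgesG m))
    ≡⟨ sum-map-filter IsListedEdge? _ (cartesianProduct V V) ⟩
  sum (map (λ e → listed (proj₁ e) (proj₂ e) * F (proj₁ e) (proj₂ e)) (cartesianProduct V V))
    ≡⟨ sum-map-cartesianProduct _ V V ⟩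
  sum (map (λ u → sum (map (λ v → listed u v * F u v) V)) V)
    ≡⟨ cong sum (map-cong (λ u → sum-map-allGVertices m _) V) ⟩
  sum (map (λ u → ∑ᵥ (λ v → listed u v * F u v)) V)
    ≡⟨ sum-map-allGVertices m _ ⟩
  ∑ᵥ (λ u → ∑ᵥ (λ v → listed u v * F u v)) ∎
  where
  open ≡-Reasoning
  V = allGVertices m

2*sum-map-edgesG : ∀ m (F : GVertex m → GVertex m → ℕ) → (∀ u v → F u v ≡ F v u) →
  2 * sum (map (λ e → F (proj₁ e) (proj₂ e)) (edgesG m)) ≡ ∑ᵥ (λ u → ∑ᵥ (λ v → adjacency u v * F u v))
2*sum-map-edgesG m F F-sym = begin
  2 * S
    ≡⟨ cong (S +_) (+-identityʳ S) ⟩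
  S + S
    ≡⟨ cong₂ _+_ (sum-map-edgesG m F) (trans (sum-map-edgesG m F) (∑ᵥ-comm {m} _)) ⟩
  ∑ᵥ (λ u → ∑ᵥ (forward u)) + ∑ᵥ (λ u → ∑ᵥ (λ v → listed v u * F v u))
    ≡⟨ cong (∑ᵥ (λ u → ∑ᵥ (forward u)) +_)
            (∑ᵥ-cong {m} (λ u → ∑ᵥ-cong {m} (λ v → cong (listed v u *_) (F-sym v u)))) ⟩
  ∑ᵥ (λ u → ∑ᵥ (forward u)) + ∑ᵥ (λ u → ∑ᵥ (backward u))
    ≡⟨ ∑ᵥ∑ᵥ-distrib-+ forward backward ⟨
  ∑ᵥ (λ u → ∑ᵥ (λ v → forward u v + backward u v))
    ≡⟨ ∑ᵥ-cong {m} (λ u → ∑ᵥ-cong {m} (λ v → trans (sym (*-distribʳ-+ (F u v) (listed u v) _))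
                                                   (cong (_* F u v) (listed+listed≡adjacency u v)))) ⟩
  ∑ᵥ (λ u → ∑ᵥ (λ v → adjacency u v * F u v)) ∎
  where
  open ≡-Reasoning
  S = sum (map (λ e → F (proj₁ e) (proj₂ e)) (edgesG m))
  forward backward : GVertex m → GVertex m → ℕ
  forward  u v = listed u v * F u v
  backward u v = listed v u * F u v

-- Hamming distance and geodesics in Q_n

bitDiff-sym : ∀ a b → bitDiff a b ≡ bitDiff b a
bitDiff-sym false false = refl
bitDiff-sym false true  = refl
bitDiff-sym true  false = refl
bitDiff-sym true  true  = refl

bitDiff-self : ∀ a → bitDiff a a ≡ 0
bitDiff-self false = refl
bitDiff-self true  = refl

bitDiff-triangle : ∀ a b c → bitDiff a c ≤ bitDiff a b + bitDiff b c
bitDiff-triangle false false c     = ≤-refl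
bitDiff-triangle true  true  c     = ≤-refl
bitDiff-triangle false true  false = z≤n
bitDiff-triangle false true  true  = s≤s z≤n
bitDiff-triangle true  false false = s≤s z≤n
bitDiff-triangle true  false true  = z≤n

hamming-∑ : ∀ {n} (x y : QVertex n) → hamming x y ≡ ∑[ i < n ] bitDiff (lookup x i) (lookup y i)
hamming-∑ []      []      = refl
hamming-∑ (a ∷ x) (b ∷ y) = cong (bitDiff a b +_) (hamming-∑ x y)

hamming-sym : ∀ {n} (x y : QVertex n) → hamming x y ≡ hamming y x
hamming-sym []      []      = refl
hamming-sym (a ∷ x) (b ∷ y) = cong₂ _+_ (bitDiff-sym a b) (hamming-sym x y)

hamming-self : ∀ {n} (x : QVertex n) → hamming x x ≡ 0
hamming-self []      = refl
hamming-self (a ∷ x) = cong₂ _+_ (bitDiff-self a) (hamming-self x)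

hamming-triangle : ∀ {n} (x y z : QVertex n) → hamming x z ≤ hamming x y + hamming y z
hamming-triangle {n} x y z = begin
  hamming x z
    ≡⟨ hamming-∑ x z ⟩
  ∑[ i < n ] bitDiff (x ‼ i) (z ‼ i)
    ≤⟨ ∑-mono (λ i → bitDiff-triangle (x ‼ i) (y ‼ i) (z ‼ i)) ⟩
  ∑[ i < n ] (bitDiff (x ‼ i) (y ‼ i) + bitDiff (y ‼ i) (z ‼ i))
    ≡⟨ ∑-distrib-+ (λ i → bitDiff (x ‼ i) (y ‼ i)) _ ⟩
  ∑[ i < n ] bitDiff (x ‼ i) (y ‼ i) + ∑[ i < n ] bitDiff (y ‼ i) (z ‼ i)
    ≡⟨ cong₂ _+_ (hamming-∑ x y) (hamming-∑ y z) ⟨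
  hamming x y + hamming y z ∎
  where
  open ≤-Reasoning
  _‼_ : QVertex n → Fin n → Bool
  _‼_ = lookup

hamming≤length : ∀ {n} (x y : QVertex n) zs → WalkQ x y zs → hamming x y ≤ length zs
hamming≤length x y []       refl         = ≤-reflexive (hamming-self x)
hamming≤length x y (z ∷ zs) (x~z , z⋯y) = begin
  hamming x y                ≤⟨ hamming-triangle x z y ⟩
  hamming x z + hamming z y  ≡⟨ cong (_+ hamming z y) x~z ⟩
  suc (hamming z y)          ≤⟨ s≤s (hamming≤length z y zs z⋯y) ⟩
  suc (length zs)            ∎
  where open ≤-Reasoning

geodesic : ∀ {n} → QVertex n → QVertex n → List (QVertex n)
geodesic []          []          = []
geodesic (false ∷ x) (false ∷ y) = map (false ∷_) (geodesic x y)
geodesic (true  ∷ x) (true  ∷ y) = map (true ∷_) (geodesic x y)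
geodesic (false ∷ x) (true  ∷ y) = (true ∷ x) ∷ map (true ∷_) (geodesic x y)
geodesic (true  ∷ x) (false ∷ y) = (false ∷ x) ∷ map (false ∷_) (geodesic x y)

length-geodesic : ∀ {n} (x y : QVertex n) → length (geodesic x y) ≡ hamming x y
length-geodesic []          []          = refl
length-geodesic (false ∷ x) (false ∷ y) = trans (length-map _ (geodesic x y)) (length-geodesic x y)
length-geodesic (true  ∷ x) (true  ∷ y) = trans (length-map _ (geodesic x y)) (length-geodesic x y)
length-geodesic (false ∷ x) (true  ∷ y) =
  cong suc (trans (length-map _ (geodesic x y)) (length-geodesic x y))
length-geodesic (true  ∷ x) (false ∷ y) =
  cong suc (trans (length-map _ (geodesic x y)) (length-geodesic x y))

walk-map-∷ : ∀ {n} c {x y : QVertex n} zs → WalkQ x y zs → WalkQ (c ∷ x) (c ∷ y) (map (c ∷_) zs)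
walk-map-∷ c     []       refl          = refl
walk-map-∷ c {x} (z ∷ zs) (x~z , z⋯y) =
  trans (cong (_+ hamming x z) (bitDiff-self c)) x~z , walk-map-∷ c zs z⋯y

geodesic-walk : ∀ {n} (x y : QVertex n) → WalkQ x y (geodesic x y)
geodesic-walk []          []          = refl
geodesic-walk (false ∷ x) (false ∷ y) = walk-map-∷ false _ (geodesic-walk x y)
geodesic-walk (true  ∷ x) (true  ∷ y) = walk-map-∷ true _ (geodesic-walk x y)
geodesic-walk (false ∷ x) (true  ∷ y) = cong suc (hamming-self x) , walk-map-∷ true _ (geodesic-walk x y)
geodesic-walk (true  ∷ x) (false ∷ y) = cong suc (hamming-self x) , walk-map-∷ false _ (geodesic-walk x y)

hamming-self<suc : ∀ {n} (x : QVertex n) k → hamming x x < suc k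
hamming-self<suc x k = s≤s (subst (_≤ k) (sym (hamming-self x)) z≤n)

geodesic-moves-away : ∀ {n} (x y : QVertex n) →
  AllPairs (λ u v → hamming x u < hamming x v) (x ∷ geodesic x y)
geodesic-moves-away []          []          = All.[] ∷ []
geodesic-moves-away (false ∷ x) (false ∷ y) = AllPairs.map⁺ (geodesic-moves-away x y)
geodesic-moves-away (true  ∷ x) (true  ∷ y) = AllPairs.map⁺ (geodesic-moves-away x y)
geodesic-moves-away (false ∷ x) (true  ∷ y) =
  All.map⁺ (All.universal (λ u → hamming-self<suc (false ∷ x) (hamming x u)) (x ∷ geodesic x y))
  ∷ AllPairs.map⁺ (AllPairs.map s≤s (geodesic-moves-away x y))
geodesic-moves-away (true  ∷ x) (false ∷ y) =
  All.map⁺ (All.universal (λ u → hamming-self<suc (true ∷ x) (hamming x u)) (x ∷ geodesic x y))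
  ∷ AllPairs.map⁺ (AllPairs.map s≤s (geodesic-moves-away x y))

geodesic-isPath : ∀ {n} (x y : QVertex n) → IsPathQ x y (geodesic x y)
geodesic-isPath x y = geodesic-walk x y ,
  AllPairs.map (λ d<d u≡v → <-irrefl (cong (hamming x) u≡v) d<d) (geodesic-moves-away x y)

-- Coordinates of 2ⁿ distinct vertices of Q_n are balanced

count : ∀ {n} → Fin n → List (QVertex n) → ℕ
count i L = sum (map (λ v → bit (lookup v i)) L)

tailsWith : ∀ {n} → Bool → List (QVertex (suc n)) → List (QVertex n)
tailsWith b []             = []
tailsWith b ((c ∷ v) ∷ L) with c Bool.≟ b
... | yes _ = v ∷ tailsWith b L
... | no  _ = tailsWith b L

tailsWith-∉ : ∀ {n} b (v : QVertex n) L → All ((b ∷ v) ≢_) L → All (v ≢_) (tailsWith b L)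
tailsWith-∉ b v []             All.[]             = All.[]
tailsWith-∉ b v ((c ∷ w) ∷ L) (bv≢cw All.∷ ps) with c Bool.≟ b
... | yes refl = (λ v≡w → bv≢cw (cong (c ∷_) v≡w)) All.∷ tailsWith-∉ b v L ps
... | no  _    = tailsWith-∉ b v L ps

tailsWith-unique : ∀ {n} b (L : List (QVertex (suc n))) → Unique L → Unique (tailsWith b L)
tailsWith-unique b []             []       = []
tailsWith-unique b ((c ∷ v) ∷ L) (v∉ ∷ u) with c Bool.≟ b
... | yes refl = tailsWith-∉ c v L v∉ ∷ tailsWith-unique b L u
... | no  _    = tailsWith-unique b L u

length-tailsWith : ∀ {n} (L : List (QVertex (suc n))) →
  length L ≡ length (tailsWith false L) + length (tailsWith true L)
length-tailsWith []                 = refl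
length-tailsWith ((false ∷ v) ∷ L) = cong suc (length-tailsWith L)
length-tailsWith ((true  ∷ v) ∷ L) = trans (cong suc (length-tailsWith L)) (sym (+-suc _ _))

count-zero : ∀ {n} (L : List (QVertex (suc n))) → count zero L ≡ length (tailsWith true L)
count-zero []                 = refl
count-zero ((false ∷ v) ∷ L) = count-zero L
count-zero ((true  ∷ v) ∷ L) = cong suc (count-zero L)

count-suc : ∀ {n} (i : Fin n) (L : List (QVertex (suc n))) →
  count (suc i) L ≡ count i (tailsWith false L) + count i (tailsWith true L)
count-suc i []                 = refl
count-suc i ((false ∷ v) ∷ L) =
  trans (cong (bit (lookup v i) +_) (count-suc i L)) (sym (+-assoc (bit (lookup v i)) _ _))
count-suc i ((true  ∷ v) ∷ L) =
  trans (cong (bit (lookup v i) +_) (count-suc i L))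
        (x∙yz≈y∙xz (bit (lookup v i)) (count i (tailsWith false L)) _)

unique-length≤ : ∀ n (L : List (QVertex n)) → Unique L → length L ≤ 2 ^ n
unique-length≤ zero    []             _                   = z≤n
unique-length≤ zero    ([] ∷ [])      _                   = ≤-refl
unique-length≤ zero    ([] ∷ [] ∷ L) ((≢[] All.∷ _) ∷ _) = ⊥-elim (≢[] refl)
unique-length≤ (suc n) L              u                   = begin
  length L                                                ≡⟨ length-tailsWith L ⟩
  length (tailsWith false L) + length (tailsWith true L)  ≤⟨ +-mono-≤ (bound false) (bound true) ⟩
  2 ^ n + 2 ^ n                                           ≡⟨ cong (2 ^ n +_) (+-identityʳ (2 ^ n)) ⟨
  2 ^ suc n                                               ∎
  where
  open ≤-Reasoning
  bound : ∀ b → length (tailsWith b L) ≤ 2 ^ n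
  bound b = unique-length≤ n (tailsWith b L) (tailsWith-unique b L u)

≤-saturated : ∀ {a b c} → a ≤ c → b ≤ c → a + b ≡ c + c → a ≡ c
≤-saturated {a} a≤c b≤c a+b≡c+c =
  ≤-antisym a≤c (+-cancelʳ-≤ _ _ a (≤-trans (≤-reflexive (sym a+b≡c+c)) (+-monoʳ-≤ a b≤c)))

length-tailsWith-full : ∀ n (L : List (QVertex (suc n))) → Unique L → length L ≡ 2 ^ suc n →
  ∀ b → length (tailsWith b L) ≡ 2 ^ n
length-tailsWith-full n L u full = λ where
    false → ≤-saturated (bound false) (bound true) halves
    true  → ≤-saturated (bound true) (bound false) (trans (+-comm (length (tailsWith true L)) _) halves)
  where
  bound : ∀ b → length (tailsWith b L) ≤ 2 ^ n
  bound b = unique-length≤ n (tailsWith b L) (tailsWith-unique b L u)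
  halves : length (tailsWith false L) + length (tailsWith true L) ≡ 2 ^ n + 2 ^ n
  halves = trans (sym (length-tailsWith L)) (trans full (cong (2 ^ n +_) (+-identityʳ (2 ^ n))))

count-full : ∀ n (L : List (QVertex (suc n))) → Unique L → length L ≡ 2 ^ suc n →
  ∀ i → count i L ≡ 2 ^ n
count-full n       L u full zero    = trans (count-zero L) (length-tailsWith-full n L u full true)
count-full (suc n) L u full (suc i) = begin
  count (suc i) L                                          ≡⟨ count-suc i L ⟩
  count i (tailsWith false L) + count i (tailsWith true L) ≡⟨ cong₂ _+_ (half false) (half true) ⟩
  2 ^ n + 2 ^ n                                            ≡⟨ cong (2 ^ n +_) (+-identityʳ (2 ^ n)) ⟨
  2 ^ suc n                                                ∎
  where
  open ≡-Reasoning
  half : ∀ b → count i (tailsWith b L) ≡ 2 ^ n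
  half b = count-full n (tailsWith b L) (tailsWith-unique b L u) (length-tailsWith-full (suc n) L u full b) i

-- An edge-isoperimetric inequality for K_m □ K_m

weight : ∀ {m} → (Fin m → Bool) → ℕ
weight {m} c = ∑[ h < m ] bit (c h)

distance : ∀ {m} → (Fin m → Bool) → (Fin m → Bool) → ℕ
distance {m} c d = ∑[ h < m ] bitDiff (c h) (d h)

bit≤1 : ∀ p → bit p ≤ 1
bit≤1 false = z≤n
bit≤1 true  = ≤-refl

weight≤length : ∀ {m} (c : Fin m → Bool) → weight c ≤ m
weight≤length {m} c =
  ≤-trans (∑-mono (λ h → bit≤1 (c h))) (≤-reflexive (trans (∑-const m 1) (*-identityʳ m)))

∣n-1+n∣≡1 : ∀ n → ∣ n - suc n ∣ ≡ 1
∣n-1+n∣≡1 zero    = refl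
∣n-1+n∣≡1 (suc n) = ∣n-1+n∣≡1 n

∣bit+m-bit+n∣≤bitDiff+∣m-n∣ : ∀ p q m n → ∣ bit p + m - bit q + n ∣ ≤ bitDiff p q + ∣ m - n ∣
∣bit+m-bit+n∣≤bitDiff+∣m-n∣ false false m n = ≤-refl
∣bit+m-bit+n∣≤bitDiff+∣m-n∣ true  true  m n = ≤-refl
∣bit+m-bit+n∣≤bitDiff+∣m-n∣ true  false m n = begin
  ∣ suc m - n ∣              ≤⟨ ∣-∣-triangle (suc m) m n ⟩
  ∣ suc m - m ∣ + ∣ m - n ∣  ≡⟨ cong (_+ ∣ m - n ∣) (trans (∣-∣-comm (suc m) m) (∣n-1+n∣≡1 m)) ⟩
  1 + ∣ m - n ∣              ∎
  where open ≤-Reasoning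
∣bit+m-bit+n∣≤bitDiff+∣m-n∣ false true  m n = begin
  ∣ m - suc n ∣              ≤⟨ ∣-∣-triangle m n (suc n) ⟩
  ∣ m - n ∣ + ∣ n - suc n ∣  ≡⟨ trans (cong (∣ m - n ∣ +_) (∣n-1+n∣≡1 n)) (+-comm ∣ m - n ∣ 1) ⟩
  1 + ∣ m - n ∣              ∎
  where open ≤-Reasoning

∣weight-weight∣≤distance : ∀ {m} (c d : Fin m → Bool) → ∣ weight c - weight d ∣ ≤ distance c d
∣weight-weight∣≤distance {zero}  c d = z≤n
∣weight-weight∣≤distance {suc m} c d =
  ≤-trans (∣bit+m-bit+n∣≤bitDiff+∣m-n∣ (c zero) (d zero) (weight (c ∘ suc)) (weight (d ∘ suc)))
          (+-monoʳ-≤ (bitDiff (c zero) (d zero)) (∣weight-weight∣≤distance (c ∘ suc) (d ∘ suc)))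

∣weight-weight∣²≤length*distance : ∀ {m} (c d : Fin m → Bool) →
  ∣ weight c - weight d ∣ * ∣ weight c - weight d ∣ ≤ m * distance c d
∣weight-weight∣²≤length*distance c d =
  *-mono-≤ (≤-trans (∣m-n∣≤m⊔n (weight c) (weight d)) (⊔-lub (weight≤length c) (weight≤length d)))
           (∣weight-weight∣≤distance c d)

bitDiff+2bit*bit≡bit+bit : ∀ p q → bitDiff p q + 2 * (bit p * bit q) ≡ bit p + bit q
bitDiff+2bit*bit≡bit+bit false false = refl
bitDiff+2bit*bit≡bit+bit false true  = refl
bitDiff+2bit*bit≡bit+bit true  false = refl
bitDiff+2bit*bit≡bit+bit true  true  = refl

∑²-bitDiff : ∀ {m} (c : Fin m → Bool) →
  ∑² (λ h h' → bitDiff (c h) (c h')) + 2 * (weight c * weight c) ≡ 2 * (m * weight c)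
∑²-bitDiff c = ∑²-quadratic _ (bit ∘ c) (bit ∘ c) (λ h h' → bitDiff+2bit*bit≡bit+bit (c h) (c h'))

∣m-n∣²+2mn≡m²+n² : ∀ p q → ∣ p - q ∣ * ∣ p - q ∣ + 2 * (p * q) ≡ p * p + q * q
∣m-n∣²+2mn≡m²+n² p q = [ ordered , (λ q≤p → swapped (ordered q≤p)) ]′ (≤-total p q)
  where
  ordered : ∀ {p q} → p ≤ q → ∣ p - q ∣ * ∣ p - q ∣ + 2 * (p * q) ≡ p * p + q * q
  ordered {p} p≤q with m≤n⇒∃[o]m+o≡n p≤q
  ... | d , refl rewrite ∣m-m+n∣≡n p d = square-offset p d
    where
    square-offset : ∀ p d → d * d + 2 * (p * (p + d)) ≡ p * p + (p + d) * (p + d)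
    square-offset = solve-∀
  swapped : ∣ q - p ∣ * ∣ q - p ∣ + 2 * (q * p) ≡ q * q + p * p →
            ∣ p - q ∣ * ∣ p - q ∣ + 2 * (p * q) ≡ p * p + q * q
  swapped eq = begin
    ∣ p - q ∣ * ∣ p - q ∣ + 2 * (p * q)  ≡⟨ cong₂ (λ s t → s * s + 2 * t) (∣-∣-comm p q) (*-comm p q) ⟩
    ∣ q - p ∣ * ∣ q - p ∣ + 2 * (q * p)  ≡⟨ eq ⟩
    q * q + p * p                        ≡⟨ +-comm (q * q) (p * p) ⟩
    p * p + q * q                        ∎
    where open ≡-Reasoning

∑²-∣-∣² : ∀ {m} (a : Fin m → ℕ) →
  ∑² (λ i j → ∣ a i - a j ∣ * ∣ a i - a j ∣) + 2 * (∑ a * ∑ a) ≡ 2 * (m * ∑[ i < m ] (a i * a i))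
∑²-∣-∣² a = ∑²-quadratic _ a (λ i → a i * a i) (λ i j → ∣m-n∣²+2mn≡m²+n² (a i) (a j))

size : ∀ {m} → (Fin m → Fin m → Bool) → ℕ
size {m} x = ∑[ g < m ] weight (x g)

-- Counts ordered pairs of adjacent vertices, so every edge of the cut is counted twice.
boundary : ∀ {m} → (Fin m → Fin m → Bool) → ℕ
boundary x = ∑ᵥ (λ u → ∑ᵥ (λ v → adjacency u v * bitDiff (uncurry x u) (uncurry x v)))

rowDisagreements : ∀ {m} → (Fin m → Fin m → Bool) → ℕ
rowDisagreements {m} x = ∑[ g < m ] ∑² (λ h h' → bitDiff (x g h) (x g h'))

columnDisagreements : ∀ {m} → (Fin m → Fin m → Bool) → ℕ
columnDisagreements x = ∑² (λ g g' → distance (x g) (x g'))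

spread : ∀ {m} → (Fin m → Fin m → Bool) → ℕ
spread x = ∑² (λ g g' → ∣ weight (x g) - weight (x g') ∣ * ∣ weight (x g) - weight (x g') ∣)

adjacency-bitDiff : ∀ {m} (x : Fin m → Fin m → Bool) g h g' h' →
  adjacency (g , h) (g' , h') * bitDiff (x g h) (x g' h') ≡
  δ g g' * bitDiff (x g h) (x g h') + δ h h' * bitDiff (x g h) (x g' h)
adjacency-bitDiff x g h g' h' with g ≟ g' | h ≟ h'
... | yes refl | yes refl = sym (cong₂ _+_ 1*self≡0 1*self≡0)
  where
  1*self≡0 : 1 * bitDiff (x g h) (x g h) ≡ 0
  1*self≡0 = trans (*-identityˡ _) (bitDiff-self (x g h))
... | yes refl | no _     = sym (+-identityʳ _)
... | no _     | yes refl = refl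
... | no _     | no _     = refl

boundary≡rows+columns : ∀ {m} (x : Fin m → Fin m → Bool) →
  boundary x ≡ rowDisagreements x + columnDisagreements x
boundary≡rows+columns {m} x = begin
  boundary x
    ≡⟨ ∑ᵥ-cong (λ (g , h) → ∑ᵥ-cong (λ (g' , h') → adjacency-bitDiff x g h g' h')) ⟩
  ∑ᵥ (λ u → ∑ᵥ (λ v → rowTerm u v + columnTerm u v))
    ≡⟨ ∑ᵥ∑ᵥ-distrib-+ rowTerm columnTerm ⟩
  ∑ᵥ (λ u → ∑ᵥ (rowTerm u)) + ∑ᵥ (λ u → ∑ᵥ (columnTerm u))
    ≡⟨ cong₂ _+_ (∑²-cong rows) (∑²-cong columns) ⟩
  ∑² (λ g h → ∑[ h' < m ] rowPair g h h') + ∑² (λ g h → ∑[ g' < m ] columnPair g h g')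
    ≡⟨ cong (rowDisagreements x +_) (sum-cong-≗ (λ g → ∑-comm (columnPair g))) ⟩
  rowDisagreements x + columnDisagreements x ∎
  where
  open ≡-Reasoning
  rowPair columnPair : Fin m → Fin m → Fin m → ℕ
  rowPair    g h h' = bitDiff (x g h) (x g h')
  columnPair g h g' = bitDiff (x g h) (x g' h)
  rowTerm columnTerm : GVertex m → GVertex m → ℕ
  rowTerm    (g , h) (g' , h') = δ g g' * rowPair g h h'
  columnTerm (g , h) (g' , h') = δ h h' * columnPair g h g'
  rows : ∀ g h → ∑ᵥ (rowTerm (g , h)) ≡ ∑[ h' < m ] rowPair g h h'
  rows g h = trans (sum-cong-≗ (λ g' → sym (*-distribˡ-sum (δ g g') (rowPair g h)))) (∑-δ g _)
  columns : ∀ g h → ∑ᵥ (columnTerm (g , h)) ≡ ∑[ g' < m ] columnPair g h g'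
  columns g h = sum-cong-≗ (λ g' → ∑-δ h (λ _ → columnPair g h g'))

rowDisagreements-identity : ∀ {m} (x : Fin m → Fin m → Bool) →
  rowDisagreements x + 2 * ∑[ g < m ] (weight (x g) * weight (x g)) ≡ 2 * (m * size x)
rowDisagreements-identity {m} x = begin
  ∑[ g < m ] R g + 2 * ∑[ g < m ] (A g * A g)    ≡⟨ cong (∑ R +_) (*-distribˡ-sum 2 (λ g → A g * A g)) ⟩
  ∑[ g < m ] R g + ∑[ g < m ] (2 * (A g * A g))  ≡⟨ ∑-distrib-+ R (λ g → 2 * (A g * A g)) ⟨
  ∑[ g < m ] (R g + 2 * (A g * A g))             ≡⟨ sum-cong-≗ (λ g → ∑²-bitDiff (x g)) ⟩
  ∑[ g < m ] (2 * (m * A g))                     ≡⟨ *-distribˡ-sum 2 (λ g → m * A g) ⟨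
  2 * ∑[ g < m ] (m * A g)                       ≡⟨ cong (2 *_) (*-distribˡ-sum m A) ⟨
  2 * (m * size x)                               ∎
  where
  open ≡-Reasoning
  R A : Fin m → ℕ
  R g = ∑² (λ h h' → bitDiff (x g h) (x g h'))
  A g = weight (x g)

rows-spread-identity : ∀ {m} (x : Fin m → Fin m → Bool) →
  m * rowDisagreements x + spread x + 2 * (size x * size x) ≡ 2 * (m * (m * size x))
rows-spread-identity {m} x = begin
  m * R + spread x + 2 * (T * T)    ≡⟨ +-assoc (m * R) (spread x) _ ⟩
  m * R + (spread x + 2 * (T * T))  ≡⟨ cong (m * R +_) (∑²-∣-∣² (λ g → weight (x g))) ⟩
  m * R + 2 * (m * Q)               ≡⟨ factor m R Q ⟩
  m * (R + 2 * Q)                   ≡⟨ cong (m *_) (rowDisagreements-identity x) ⟩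
  m * (2 * (m * T))                 ≡⟨ swap m (m * T) ⟩
  2 * (m * (m * T))                 ∎
  where
  open ≡-Reasoning
  R T Q : ℕ
  R = rowDisagreements x
  T = size x
  Q = ∑[ g < m ] (weight (x g) * weight (x g))
  factor : ∀ m R Q → m * R + 2 * (m * Q) ≡ m * (R + 2 * Q)
  factor = solve-∀
  swap : ∀ m t → m * (2 * t) ≡ 2 * (m * t)
  swap = solve-∀

m*boundary≡m*rows+m*columns : ∀ {m} (x : Fin m → Fin m → Bool) →
  m * boundary x ≡ m * rowDisagreements x + m * columnDisagreements x
m*boundary≡m*rows+m*columns {m} x = trans (cong (m *_) (boundary≡rows+columns x)) (*-distribˡ-+ m _ _)

spread≤length*columnDisagreements : ∀ {m} (x : Fin m → Fin m → Bool) →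
  spread x ≤ m * columnDisagreements x
spread≤length*columnDisagreements {m} x = begin
  spread x
    ≤⟨ ∑²-mono (λ g g' → ∣weight-weight∣²≤length*distance (x g) (x g')) ⟩
  ∑² (λ g g' → m * distance (x g) (x g'))
    ≡⟨ *-distribˡ-∑² m (λ g g' → distance (x g) (x g')) ⟨
  m * columnDisagreements x ∎
  where open ≤-Reasoning

-- With S the set of ones of x, this is m · |∂S| ≥ |S| · (m² − |S|).
rook-isoperimetric : ∀ {m} (x : Fin m → Fin m → Bool) →
  2 * (m * (m * size x)) ≤ m * boundary x + 2 * (size x * size x)
rook-isoperimetric {m} x = begin
  2 * (m * (m * size x))     ≡⟨ rows-spread-identity x ⟨
  m * R + spread x + 2T²     ≤⟨ +-monoˡ-≤ 2T² (+-monoʳ-≤ (m * R) (spread≤length*columnDisagreements x)) ⟩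
  m * R + m * C + 2T²        ≡⟨ cong (_+ 2T²) (m*boundary≡m*rows+m*columns x) ⟨
  m * boundary x + 2T²       ∎
  where
  open ≤-Reasoning
  R C 2T² : ℕ
  R   = rowDisagreements x
  C   = columnDisagreements x
  2T² = 2 * (size x * size x)

DependsOnOneIndex : ∀ {m} → (Fin m → Fin m → Bool) → Set
DependsOnOneIndex {m} x =
  (∃ λ (c : Fin m → Bool) → ∀ g h → x g h ≡ c g) ⊎
  (∃ λ (d : Fin m → Bool) → ∀ g h → x g h ≡ d h)

m*[m*bitDiff]≤∣m*bit-m*bit∣² : ∀ m p q →
  m * (m * bitDiff p q) ≤ ∣ m * bit p - m * bit q ∣ * ∣ m * bit p - m * bit q ∣
m*[m*bitDiff]≤∣m*bit-m*bit∣² m false false rewrite *-zeroʳ m | *-zeroʳ m = z≤n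
m*[m*bitDiff]≤∣m*bit-m*bit∣² m true  true  rewrite *-zeroʳ m | *-zeroʳ m = z≤n
m*[m*bitDiff]≤∣m*bit-m*bit∣² m true  false rewrite *-identityʳ m | *-zeroʳ m | ∣-∣-identityʳ m = ≤-refl
m*[m*bitDiff]≤∣m*bit-m*bit∣² m false true  rewrite *-identityʳ m | *-zeroʳ m = ≤-refl

length*columnDisagreements≤spread : ∀ {m} (x : Fin m → Fin m → Bool) → DependsOnOneIndex x →
  m * columnDisagreements x ≤ spread x
length*columnDisagreements≤spread {m} x oneIndex = begin
  m * columnDisagreements x                ≡⟨ *-distribˡ-∑² m (λ g g' → distance (x g) (x g')) ⟩
  ∑² (λ g g' → m * distance (x g) (x g'))  ≤⟨ ∑²-mono (pointwise oneIndex) ⟩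
  spread x                                 ∎
  where
  open ≤-Reasoning
  pointwise : DependsOnOneIndex x → ∀ g g' →
    m * distance (x g) (x g') ≤ ∣ weight (x g) - weight (x g') ∣ * ∣ weight (x g) - weight (x g') ∣
  pointwise (inj₁ (c , x≡c)) g g' =
    subst₂ _≤_ (cong (m *_) (sym distance≡))
               (cong₂ (λ s t → ∣ s - t ∣ * ∣ s - t ∣) (sym (weight≡ g)) (sym (weight≡ g')))
               (m*[m*bitDiff]≤∣m*bit-m*bit∣² m (c g) (c g'))
    where
    distance≡ : distance (x g) (x g') ≡ m * bitDiff (c g) (c g')
    distance≡ = trans (sum-cong-≗ (λ h → cong₂ bitDiff (x≡c g h) (x≡c g' h))) (∑-const m _)
    weight≡ : ∀ g → weight (x g) ≡ m * bit (c g)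
    weight≡ g = trans (sum-cong-≗ (λ h → cong bit (x≡c g h))) (∑-const m _)
  pointwise (inj₂ (d , x≡d)) g g' = ≤-trans (≤-reflexive (trans (cong (m *_) distance≡0) (*-zeroʳ m))) z≤n
    where
    distance≡0 : distance (x g) (x g') ≡ 0
    distance≡0 = trans (sum-cong-≗ (λ h → trans (cong₂ bitDiff (x≡d g h) (x≡d g' h)) (bitDiff-self (d h))))
                       (trans (∑-const m 0) (*-zeroʳ m))

rook-isoperimetric-tight : ∀ {m} (x : Fin m → Fin m → Bool) → DependsOnOneIndex x →
  m * boundary x + 2 * (size x * size x) ≤ 2 * (m * (m * size x))
rook-isoperimetric-tight {m} x oneIndex = begin
  m * boundary x + 2T²    ≡⟨ cong (_+ 2T²) (m*boundary≡m*rows+m*columns x) ⟩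
  m * R + m * C + 2T²     ≤⟨ +-monoˡ-≤ 2T² (+-monoʳ-≤ (m * R) (length*columnDisagreements≤spread x oneIndex)) ⟩
  m * R + spread x + 2T²  ≡⟨ rows-spread-identity x ⟩
  2 * (m * (m * size x))  ∎
  where
  open ≤-Reasoning
  R C 2T² : ℕ
  R   = rowDisagreements x
  C   = columnDisagreements x
  2T² = 2 * (size x * size x)

balanced-square : ∀ m T → 2 * T ≡ m * m → 2 * (m * (m * T)) ≡ m * (m * T) + 2 * (T * T)
balanced-square m T 2T≡m² = begin
  2 * (m * (m * T))          ≡⟨ cong (m * (m * T) +_) (+-identityʳ (m * (m * T))) ⟩
  m * (m * T) + m * (m * T)  ≡⟨ cong (m * (m * T) +_) 2T²≡m²T ⟨
  m * (m * T) + 2 * (T * T)  ∎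
  where
  open ≡-Reasoning
  2T²≡m²T : 2 * (T * T) ≡ m * (m * T)
  2T²≡m²T = trans (sym (*-assoc 2 T T)) (trans (cong (_* T) 2T≡m²) (*-assoc m m T))

rook-boundary-balanced : ∀ {m} (x : Fin m → Fin m → Bool) → 2 * size x ≡ m * m →
  m * size x ≤ boundary x
rook-boundary-balanced {zero}  x _      = z≤n
rook-boundary-balanced {suc k} x halved = *-cancelˡ-≤ m (+-cancelʳ-≤ (2 * (T * T)) _ _ (begin
  m * (m * T) + 2 * (T * T)     ≡⟨ balanced-square m T halved ⟨
  2 * (m * (m * T))             ≤⟨ rook-isoperimetric x ⟩
  m * boundary x + 2 * (T * T)  ∎))
  where
  open ≤-Reasoning
  m = suc k
  T = size x

rook-boundary-balanced-tight : ∀ {m} (x : Fin m → Fin m → Bool) → DependsOnOneIndex x →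
  2 * size x ≡ m * m → boundary x ≤ m * size x
rook-boundary-balanced-tight {zero}  x _        _      = z≤n
rook-boundary-balanced-tight {suc k} x oneIndex halved = *-cancelˡ-≤ m (+-cancelʳ-≤ (2 * (T * T)) _ _ (begin
  m * boundary x + 2 * (T * T)  ≤⟨ rook-isoperimetric-tight x oneIndex ⟩
  2 * (m * (m * T))             ≡⟨ balanced-square m T halved ⟩
  m * (m * T) + 2 * (T * T)     ∎))
  where
  open ≤-Reasoning
  m = suc k
  T = size x

coordinate : ∀ {m n} → (GVertex m → QVertex n) → Fin n → Fin m → Fin m → Bool
coordinate f i g h = lookup (f (g , h)) i

hammingSum : ∀ {m n} → (GVertex m → QVertex n) → ℕ
hammingSum {m} f = sum (map (λ e → hamming (f (proj₁ e)) (f (proj₂ e))) (edgesG m))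

hammingSum≤wirelength : ∀ {m n} (E : Embedding m n) → hammingSum (Embedding.f E) ≤ wirelength E
hammingSum≤wirelength {m} E =
  sum-map-mono-∈ (edgesG m) (λ e e∈ → hamming≤length _ _ _ (proj₁ (Embedding.P-ok E e∈)))

geodesicEmbedding : ∀ {m n} (f : GVertex m → QVertex n) → Injective _≡_ _≡_ f → Embedding m n
geodesicEmbedding f f-inj = record
  { f     = f
  ; f-inj = f-inj
  ; P     = λ u v → geodesic (f u) (f v)
  ; P-ok  = λ {u} {v} _ → geodesic-isPath (f u) (f v)
  }

wirelength-geodesicEmbedding : ∀ {m n} (f : GVertex m → QVertex n) (f-inj : Injective _≡_ _≡_ f) →
  wirelength (geodesicEmbedding f f-inj) ≡ hammingSum f
wirelength-geodesicEmbedding {m} f f-inj =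
  cong sum (map-cong (λ e → length-geodesic (f (proj₁ e)) (f (proj₂ e))) (edgesG m))

2*hammingSum≡∑boundary : ∀ {m n} (f : GVertex m → QVertex n) →
  2 * hammingSum f ≡ ∑[ i < n ] boundary (coordinate f i)
2*hammingSum≡∑boundary {m} {n} f = begin
  2 * hammingSum f
    ≡⟨ 2*sum-map-edgesG m (λ u v → hamming (f u) (f v)) (λ u v → hamming-sym (f u) (f v)) ⟩
  ∑ᵥ (λ u → ∑ᵥ (λ v → adjacency u v * hamming (f u) (f v)))
    ≡⟨ ∑ᵥ-cong {m} (λ u → ∑ᵥ-cong {m} (λ v → trans (cong (adjacency u v *_) (hamming-∑ (f u) (f v)))
                                                   (*-distribˡ-sum (adjacency u v) (bitDiffAt u v)))) ⟩
  ∑ᵥ (λ u → ∑ᵥ (λ v → ∑[ i < n ] term u v i))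
    ≡⟨ ∑ᵥ-cong {m} (λ u → ∑ᵥ-comm-∑ (term u)) ⟩
  ∑ᵥ (λ u → ∑[ i < n ] ∑ᵥ (λ v → term u v i))
    ≡⟨ ∑ᵥ-comm-∑ (λ u i → ∑ᵥ (λ v → term u v i)) ⟩
  ∑[ i < n ] boundary (coordinate f i) ∎
  where
  open ≡-Reasoning
  bitDiffAt : GVertex m → GVertex m → Fin n → ℕ
  bitDiffAt u v i = bitDiff (lookup (f u) i) (lookup (f v) i)
  term : GVertex m → GVertex m → Fin n → ℕ
  term u v i = adjacency u v * bitDiffAt u v i

size-coordinate : ∀ {m n} (f : GVertex m → QVertex (suc n)) → Injective _≡_ _≡_ f →
  m * m ≡ 2 ^ suc n → ∀ i → size (coordinate f i) ≡ 2 ^ n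
size-coordinate {m} {n} f f-inj m²≡2ⁿ⁺¹ i = begin
  size (coordinate f i)                     ≡⟨ sum-map-allGVertices m _ ⟨
  sum (map (λ u → bit (lookup (f u) i)) V)  ≡⟨ cong sum (map-∘ V) ⟩
  count i (map f V)                         ≡⟨ count-full n (map f V) unique full i ⟩
  2 ^ n                                     ∎
  where
  open ≡-Reasoning
  V = allGVertices m
  unique : Unique (map f V)
  unique = Unique.map⁺ f-inj (Unique.cartesianProduct⁺ (Unique.allFin⁺ m) (Unique.allFin⁺ m))
  full : length (map f V) ≡ 2 ^ suc n
  full = trans (length-map f V)
        (trans (length-cartesianProduct (allFin m) (allFin m))
        (trans (cong₂ _*_ (length-tabulate {n = m} id) (length-tabulate {n = m} id)) m²≡2ⁿ⁺¹))

2*size-coordinate : ∀ {m n} (f : GVertex m → QVertex (suc n)) → Injective _≡_ _≡_ f →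
  m * m ≡ 2 ^ suc n → ∀ i → 2 * size (coordinate f i) ≡ m * m
2*size-coordinate f f-inj m²≡2ⁿ⁺¹ i =
  trans (cong (2 *_) (size-coordinate f f-inj m²≡2ⁿ⁺¹ i)) (sym m²≡2ⁿ⁺¹)

hammingSum-lower : ∀ {m n} (f : GVertex m → QVertex (suc n)) → Injective _≡_ _≡_ f →
  m * m ≡ 2 ^ suc n → suc n * (m * 2 ^ n) ≤ 2 * hammingSum f
hammingSum-lower {m} {n} f f-inj m²≡2ⁿ⁺¹ = begin
  suc n * (m * 2 ^ n)
    ≡⟨ ∑-const (suc n) (m * 2 ^ n) ⟨
  ∑[ i < suc n ] (m * 2 ^ n)
    ≡⟨ sum-cong-≗ (λ i → cong (m *_) (size-coordinate f f-inj m²≡2ⁿ⁺¹ i)) ⟨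
  ∑[ i < suc n ] (m * size (coordinate f i))
    ≤⟨ ∑-mono (λ i → rook-boundary-balanced (coordinate f i) (2*size-coordinate f f-inj m²≡2ⁿ⁺¹ i)) ⟩
  ∑[ i < suc n ] boundary (coordinate f i)
    ≡⟨ 2*hammingSum≡∑boundary f ⟨
  2 * hammingSum f ∎
  where open ≤-Reasoning

hammingSum-upper : ∀ {m n} (f : GVertex m → QVertex (suc n)) → Injective _≡_ _≡_ f →
  (∀ i → DependsOnOneIndex (coordinate f i)) → m * m ≡ 2 ^ suc n →
  2 * hammingSum f ≤ suc n * (m * 2 ^ n)
hammingSum-upper {m} {n} f f-inj oneIndex m²≡2ⁿ⁺¹ = begin
  2 * hammingSum f
    ≡⟨ 2*hammingSum≡∑boundary f ⟩
  ∑[ i < suc n ] boundary (coordinate f i)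
    ≤⟨ ∑-mono (λ i → rook-boundary-balanced-tight (coordinate f i) (oneIndex i)
                                                  (2*size-coordinate f f-inj m²≡2ⁿ⁺¹ i)) ⟩
  ∑[ i < suc n ] (m * size (coordinate f i))
    ≡⟨ sum-cong-≗ (λ i → cong (m *_) (size-coordinate f f-inj m²≡2ⁿ⁺¹ i)) ⟩
  ∑[ i < suc n ] (m * 2 ^ n)
    ≡⟨ ∑-const (suc n) (m * 2 ^ n) ⟩
  suc n * (m * 2 ^ n) ∎
  where open ≤-Reasoning

oneIndexEmbedding-optimal : ∀ {m n w} → m * m ≡ 2 ^ suc n → 2 * w ≡ suc n * (m * 2 ^ n) →
  (f : GVertex m → QVertex (suc n)) → Injective _≡_ _≡_ f →
  (∀ i → DependsOnOneIndex (coordinate f i)) → WLis m (suc n) w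
oneIndexEmbedding-optimal {m} {n} {w} m²≡2ⁿ⁺¹ 2w≡ f f-inj oneIndex =
  (geodesicEmbedding f f-inj , trans (wirelength-geodesicEmbedding f f-inj) hammingSum≡w) , optimal
  where
  hammingSum≡w : hammingSum f ≡ w
  hammingSum≡w = *-cancelˡ-≡ _ _ 2 (trans
    (≤-antisym (hammingSum-upper f f-inj oneIndex m²≡2ⁿ⁺¹) (hammingSum-lower f f-inj m²≡2ⁿ⁺¹))
    (sym 2w≡))
  optimal : ∀ E → w ≤ wirelength E
  optimal E = *-cancelˡ-≤ 2 (begin
    2 * w                           ≡⟨ 2w≡ ⟩
    suc n * (m * 2 ^ n)             ≤⟨ hammingSum-lower (Embedding.f E) (Embedding.f-inj E) m²≡2ⁿ⁺¹ ⟩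
    2 * hammingSum (Embedding.f E)  ≤⟨ *-monoʳ-≤ 2 (hammingSum≤wirelength E) ⟩
    2 * wirelength E                ∎)
    where open ≤-Reasoning

-- The binary embedding

funToFin-cong : ∀ {m n} {f g : Fin m → Fin n} → (∀ i → f i ≡ g i) → funToFin f ≡ funToFin g
funToFin-cong {zero}  _   = refl
funToFin-cong {suc m} f≗g = cong₂ combine (f≗g zero) (funToFin-cong (f≗g ∘ suc))

binary : ∀ k → Fin (2 ^ k) → Vec Bool k
binary k i = Vec.tabulate (Inverse.to 2↔Bool ∘ finToFun {2} {k} i)

binary-injective : ∀ k → Injective _≡_ _≡_ (binary k)
binary-injective k {i} {j} binary-i≡binary-j = begin
  i                                         ≡⟨ funToFin-finToFin {k} i ⟨
  funToFin (finToFun {2} {k} i)             ≡⟨ funToFin-cong (decode i) ⟩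
  funToFin (fromBool ∘ lookup (binary k i)) ≡⟨ cong (λ v → funToFin (fromBool ∘ lookup v)) binary-i≡binary-j ⟩
  funToFin (fromBool ∘ lookup (binary k j)) ≡⟨ funToFin-cong (decode j) ⟨
  funToFin (finToFun {2} {k} j)             ≡⟨ funToFin-finToFin {k} j ⟩
  j                                         ∎
  where
  open ≡-Reasoning
  fromBool : Bool → Fin 2
  fromBool = Inverse.from 2↔Bool
  decode : ∀ i t → finToFun {2} {k} i t ≡ fromBool (lookup (binary k i) t)
  decode i t = sym (trans (cong fromBool (lookup∘tabulate _ t))
                          (Inverse.strictlyInverseʳ 2↔Bool (finToFun i t)))

_⊗_ : ∀ {m p q} → (Fin m → Vec Bool p) → (Fin m → Vec Bool q) → GVertex m → QVertex (p + q)
(u ⊗ v) (g , h) = u g Vec.++ v h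

⊗-injective : ∀ {m p q} {u : Fin m → Vec Bool p} {v : Fin m → Vec Bool q} →
  Injective _≡_ _≡_ u → Injective _≡_ _≡_ v → Injective _≡_ _≡_ (u ⊗ v)
⊗-injective {u = u} u-inj v-inj {g , h} {g' , h'} eq =
  cong₂ _,_ (u-inj (++-injectiveˡ (u g) (u g') eq)) (v-inj (++-injectiveʳ (u g) (u g') eq))

⊗-dependsOnOneIndex : ∀ {m p q} (u : Fin m → Vec Bool p) (v : Fin m → Vec Bool q) i →
  DependsOnOneIndex (coordinate (u ⊗ v) i)
⊗-dependsOnOneIndex {p = p} u v i with splitAt p i in split≡
... | inj₁ j = inj₁ ((λ g → lookup (u g) j) , λ g h → lookup-⊗ g h)
  where
  lookup-⊗ : ∀ g h → lookup (u g Vec.++ v h) i ≡ lookup (u g) j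
  lookup-⊗ g h = trans (lookup-splitAt p (u g) (v h) i) (cong [ lookup (u g) , lookup (v h) ]′ split≡)
... | inj₂ j = inj₂ ((λ h → lookup (v h) j) , λ g h → lookup-⊗ g h)
  where
  lookup-⊗ : ∀ g h → lookup (u g Vec.++ v h) i ≡ lookup (v h) j
  lookup-⊗ g h = trans (lookup-splitAt p (u g) (v h) i) (cong [ lookup (u g) , lookup (v h) ]′ split≡)

-- 2 * k unfolds to k + (k + 0), hence the padding of the second factor by [].
binaryGrid : ∀ k → GVertex (2 ^ k) → QVertex (2 * k)
binaryGrid k = binary k ⊗ (λ h → binary k h Vec.++ [])

binaryGrid-injective : ∀ k → Injective _≡_ _≡_ (binaryGrid k)
binaryGrid-injective k = ⊗-injective (binary-injective k)
  (λ {h} {h'} eq → binary-injective k (++-injectiveˡ (binary k h) (binary k h') eq))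

binaryGrid-dependsOnOneIndex : ∀ k i → DependsOnOneIndex (coordinate (binaryGrid k) i)
binaryGrid-dependsOnOneIndex k = ⊗-dependsOnOneIndex (binary k) (λ h → binary k h Vec.++ [])

2^k*2^k≡2^[2*k] : ∀ k → 2 ^ k * 2 ^ k ≡ 2 ^ (2 * k)
2^k*2^k≡2^[2*k] k = trans (sym (^-distribˡ-+-* 2 k k)) (cong (λ t → 2 ^ (k + t)) (sym (+-identityʳ k)))

2*[n*2^[3k∸2]]≡n*[2^k*2^[n∸1]] : ∀ k → let n = 2 * suc k in
  2 * (n * 2 ^ (3 * suc k ∸ 2)) ≡ n * (2 ^ suc k * 2 ^ (n ∸ 1))
2*[n*2^[3k∸2]]≡n*[2^k*2^[n∸1]] k = begin
  2 * (n * 2 ^ (3 * suc k ∸ 2))  ≡⟨ swap n (2 ^ (3 * suc k ∸ 2)) ⟩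
  n * 2 ^ suc (3 * suc k ∸ 2)    ≡⟨ cong (λ e → n * 2 ^ suc (e ∸ 2)) (3*[1+k]≡2+[1+3k] k) ⟩
  n * 2 ^ (2 + 3 * k)            ≡⟨ cong (λ e → n * 2 ^ e) (2+3k≡[1+k]+[2k+1] k) ⟩
  n * 2 ^ (suc k + (n ∸ 1))      ≡⟨ cong (n *_) (^-distribˡ-+-* 2 (suc k) (n ∸ 1)) ⟩
  n * (2 ^ suc k * 2 ^ (n ∸ 1))  ∎
  where
  open ≡-Reasoning
  n = 2 * suc k
  swap : ∀ n t → 2 * (n * t) ≡ n * (2 * t)
  swap = solve-∀
  3*[1+k]≡2+[1+3k] : ∀ k → 3 * suc k ≡ 2 + suc (3 * k)
  3*[1+k]≡2+[1+3k] = solve-∀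
  2+3k≡[1+k]+[2k+1] : ∀ k → 2 + 3 * k ≡ suc k + (k + suc (k + 0))
  2+3k≡[1+k]+[2k+1] = solve-∀

theorem8p3 : ∀ (n k : ℕ) → 0 < n → n ≡ 2 * k →
    WLis (2 ^ k) n (n * 2 ^ (3 * k ∸ 2))
theorem8p3 .(2 * zero)  zero    () refl
theorem8p3 .(2 * suc k) (suc k) _  refl =
  oneIndexEmbedding-optimal (2^k*2^k≡2^[2*k] (suc k)) (2*[n*2^[3k∸2]]≡n*[2^k*2^[n∸1]] k)
    (binaryGrid (suc k)) (binaryGrid-injective (suc k)) (binaryGrid-dependsOnOneIndex (suc k))
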